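{- Let $l\ge1$, $n\in\{0,\dots,l\}$, and let $m$ be a positive divisor of $l$. Then \[ \#\{\mathbf{u}\in X_{l,n}\mid m\mathbf{u}=\mathbf{u}\}=2^m-L_m^n . \]
   Context: For $l\ge1$, $X_l=\{y,z\}^l$ is the set of $l$-tuples of two symbols $y,z$, with $\mathbb{Z}/l\mathbb{Z}$ acting by cyclic shifts $j(u_1,\dots,u_l)=(u_{j+1},\dots,u_{j+l})$ (indices modulo $l$); $m\mathbf{u}$ denotes the action of $m\in\mathbb{Z}/l\mathbb{Z}$ on $\mathbf{u}$. For $n\in\{0,\dots,l\}$, $X_{l,n}\subset X_l$ is the set of tuples containing at least $n$ consecutive $z$'s when read cyclically. For $n\ge1$, the $n$-step Lucas sequence is $L_m^n=2^m-1$ for $m=1,\dots,n$ and $L_m^n=L_{m-1}^n+\cdots+L_{m-n}^n$ for $m\ge n+1$; $L_m^0=0$ for all $m\ge1$. -}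

module Defs where

open import Data.Nat using (ℕ; zero; suc; _+_; _∸_; _^_; _≤?_; NonZero)
open import Data.Nat.DivMod using (_mod_)
open import Data.Fin using (Fin; toℕ)
open import Data.Fin.Properties using (any?; all?)
open import Data.Vec using (Vec; []; _∷_; lookup; tabulate)
open import Data.Vec.Properties using (≡-dec)
open import Data.List using (List; []; _∷_; map; concatMap; filter; length; upTo)
open import Data.Nat.ListAction using (sum)
open import Data.Product using (∃; _×_)
open import Relation.Nullary using (Dec; yes; no; does)
open import Relation.Binary.PropositionalEquality using (_≡_; refl)
open import Relation.Binary using (DecidableEquality)
open import Relation.Nullary.Decidable using (_×-dec_)

data Sym : Set where
  y z : Sym

_≟S_ : DecidableEquality Sym
y ≟S y = yes refl
y ≟S z = no λ ()
z ≟S y = no λ ()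
z ≟S z = yes refl

X : ℕ → Set
X l = Vec Sym l

allX : (l : ℕ) → List (X l)
allX zero = [] ∷ []
allX (suc l) = concatMap (λ v → (y ∷ v) ∷ (z ∷ v) ∷ []) (allX l)

-- action of m ∈ ℤ/lℤ (represented by any natural m) by cyclic shift:
-- (m u)_i = u_{i+m mod l}
shift : (l : ℕ) .{{_ : NonZero l}} → ℕ → X l → X l
shift l m u = tabulate λ i → lookup u ((toℕ i + m) mod l)

HasZRun : (l : ℕ) .{{_ : NonZero l}} → ℕ → X l → Set
HasZRun l n u = ∃ λ (i : Fin l) → ∀ (k : Fin n) → lookup u ((toℕ i + toℕ k) mod l) ≡ z

hasZRun? : (l : ℕ) .{{_ : NonZero l}} (n : ℕ) (u : X l) → Dec (HasZRun l n u)
hasZRun? l n u = any? λ i → all? λ k → lookup u ((toℕ i + toℕ k) mod l) ≟S z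

countFixed : (l : ℕ) .{{_ : NonZero l}} → ℕ → ℕ → ℕ
countFixed l n m =
  length (filter (λ u → hasZRun? l n u ×-dec ≡-dec _≟S_ (shift l m u) u) (allX l))

-- n-step Lucas numbers, via a fuel argument (fuel m suffices for index m)
lucasF : ℕ → ℕ → ℕ → ℕ
lucasF zero n m = 0
lucasF (suc f) n m with m ≤? n
... | yes _ = 2 ^ m ∸ 1
... | no _ = sum (map (λ j → lucasF f n (m ∸ j)) (map suc (upTo n)))

L : ℕ → ℕ → ℕ
L zero m = 0
L (suc n) m = lucasF m (suc n) m

-- An l-tuple fixed by the shift m is the periodic extension of its first m letters w, and it
-- has a cyclic run of n ≥ 1 z's exactly when the cyclic word w has one (an all-z word always
-- does). So it suffices that the cyclic words of length m containing a y but no run of n z's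
-- number L_m^n. Rotating such a word to begin right after its first y makes it a linear word;
-- classifying by the z-block before the first y and the z-block after it yields the n-step
-- recurrence, while for m ≤ n every word except z^m qualifies, giving 2^m - 1.

module Submission where

open import Algebra.Properties.CommutativeSemigroup using (interchange)
open import Data.Bool using (Bool; true; false; _∧_; not; if_then_else_)
open import Data.Bool.Properties using (∧-zeroʳ; ∧-identityʳ; if-eta)
open import Data.Fin using (Fin; toℕ; fromℕ<) renaming (zero to fzero; suc to fsuc)
open import Data.Fin.Properties using (toℕ-fromℕ<; toℕ<n)
open import Data.List using (List; []; _∷_; map; filter; length; concatMap; applyUpTo; upTo) renaming (_++_ to _++ᴸ_)
open import Data.List.Properties using (map-++; map-cong; map-∘; map-applyUpTo)
open import Data.Nat using (ℕ; zero; suc; _+_; _∸_; _^_; _≤_; _<_; z≤n; s≤s; s≤s⁻¹; z<s; s<s; _≤?_; _<?_; _<ᵇ_; NonZero)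
open import Data.Nat.DivMod using (_%_; _mod_; m%n<n; m%n%n≡m%n; [m+n]%n≡m%n; %-distribˡ-+; m<n⇒m%n≡m; m∣n⇒o%n%m≡o%m)
open import Data.Nat.Divisibility using (_∣_; ∣⇒≤)
open import Data.Nat.Induction using (<-rec)
open import Data.Nat.ListAction using (sum)
open import Data.Nat.ListAction.Properties using (sum-++)
open import Data.Nat.Properties
open import Data.Nat.Solver using (module +-*-Solver)
open import Data.Product using (Σ-syntax; _,_)
open import Data.Sum using (inj₁; inj₂)
open import Data.Vec using ([]; _∷_; _++_; replicate; lookup; tabulate)
open import Data.Vec.Properties using (lookup∘tabulate; ≡-dec)
open import Function using (_∘_; id; case_of_; _⇔_; mk⇔; Equivalence)
open import Function.Construct.Composition using (_⇔-∘_)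
open import Function.Construct.Symmetry using (⇔-sym)
open import Relation.Nullary using (Dec; yes; no; does; ¬_; contradiction)
open import Relation.Nullary.Decidable using (does-⇔; dec-true; dec-false; _×-dec_)
open import Relation.Unary using (Pred; Decidable)
open import Relation.Binary.PropositionalEquality
open ≡-Reasoning
open +-*-Solver using (solve; _:+_; _:=_; con)

open import Defs

if-true : ∀ {A : Set} {b} {x y : A} → b ≡ true → (if b then x else y) ≡ x
if-true refl = refl

if-false : ∀ {A : Set} {b} {x y : A} → b ≡ false → (if b then x else y) ≡ y
if-false refl = refl

boolToℕ : Bool → ℕ
boolToℕ b = if b then 1 else 0

boolToℕ-not : ∀ b → boolToℕ (not b) + boolToℕ b ≡ 1
boolToℕ-not true  = refl
boolToℕ-not false = refl

<⇒<ᵇ≡true : ∀ {i q} → i < q → (i <ᵇ q) ≡ true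
<⇒<ᵇ≡true {zero}  {suc q} _         = refl
<⇒<ᵇ≡true {suc i} {suc q} (s<s i<q) = <⇒<ᵇ≡true i<q

≥⇒<ᵇ≡false : ∀ {i q} → q ≤ i → (i <ᵇ q) ≡ false
≥⇒<ᵇ≡false {i}     {zero}  _         = refl
≥⇒<ᵇ≡false {suc i} {suc q} (s≤s q≤i) = ≥⇒<ᵇ≡false q≤i

<ᵇ≡false⇒≥ : ∀ i q → (i <ᵇ q) ≡ false → q ≤ i
<ᵇ≡false⇒≥ i       zero    _  = z≤n
<ᵇ≡false⇒≥ (suc i) (suc q) eq = s≤s (<ᵇ≡false⇒≥ i q eq)

<ᵇ-∸ : ∀ i N j → (i <ᵇ N ∸ j) ≡ (i + j <ᵇ N)
<ᵇ-∸ i N       zero    = cong (_<ᵇ N) (sym (+-identityʳ i))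
<ᵇ-∸ i zero    (suc j) = refl
<ᵇ-∸ i (suc N) (suc j) = trans (<ᵇ-∸ i N j) (cong (_<ᵇ suc N) (sym (+-suc i j)))

<ᵇ-∸-swap : ∀ i j N → (i <ᵇ N ∸ j) ≡ (j <ᵇ N ∸ i)
<ᵇ-∸-swap i j N = trans (<ᵇ-∸ i N j) (trans (cong (_<ᵇ N) (+-comm i j)) (sym (<ᵇ-∸ j N i)))

∸-suc-swap : ∀ N a b → N ∸ a ∸ suc b ≡ N ∸ b ∸ suc a
∸-suc-swap N a b = begin
    N ∸ a ∸ suc b   ≡⟨ ∸-+-assoc N a (suc b) ⟩
    N ∸ (a + suc b) ≡⟨ cong (N ∸_) (trans (+-suc a b) (trans (cong suc (+-comm a b)) (sym (+-suc b a)))) ⟩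
    N ∸ (b + suc a) ≡⟨ ∸-+-assoc N b (suc a) ⟨
    N ∸ b ∸ suc a   ∎

∑< : ℕ → (ℕ → ℕ) → ℕ
∑< p f = sum (applyUpTo f p)

syntax ∑< p (λ i → e) = ∑[ i < p ] e

∑-cong : ∀ p {f g : ℕ → ℕ} → (∀ i → i < p → f i ≡ g i) → ∑< p f ≡ ∑< p g
∑-cong zero    eq = refl
∑-cong (suc p) eq = cong₂ _+_ (eq 0 z<s) (∑-cong p (λ i i<p → eq (suc i) (s<s i<p)))

∑-zero : ∀ p → ∑[ i < p ] 0 ≡ 0
∑-zero zero    = refl
∑-zero (suc p) = ∑-zero p

∑-distrib-+ : ∀ p (f g : ℕ → ℕ) → ∑[ i < p ] (f i + g i) ≡ ∑< p f + ∑< p g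
∑-distrib-+ zero    f g = refl
∑-distrib-+ (suc p) f g = trans (cong (f 0 + g 0 +_) (∑-distrib-+ p (f ∘ suc) (g ∘ suc)))
  (interchange +-commutativeSemigroup (f 0) (g 0) (∑< p (f ∘ suc)) (∑< p (g ∘ suc)))

∑-comm : ∀ p q (f : ℕ → ℕ → ℕ) → ∑[ i < p ] ∑[ j < q ] f i j ≡ ∑[ j < q ] ∑[ i < p ] f i j
∑-comm zero    q f = sym (∑-zero q)
∑-comm (suc p) q f = trans (cong (∑< q (f 0) +_) (∑-comm p q (f ∘ suc)))
  (sym (∑-distrib-+ q (f 0) (λ j → ∑[ i < p ] f (suc i) j)))

∑-truncate : ∀ p q (f : ℕ → ℕ) →
  ∑[ i < p ] (if i <ᵇ q then f i else 0) ≡ ∑[ i < q ] (if i <ᵇ p then f i else 0)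
∑-truncate zero    q       f = sym (∑-zero q)
∑-truncate (suc p) zero    f = ∑-zero (suc p)
∑-truncate (suc p) (suc q) f = cong (f 0 +_) (∑-truncate p q (f ∘ suc))

lucasF-zero : ∀ N f → lucasF f N 0 ≡ 0
lucasF-zero N zero    = refl
lucasF-zero N (suc f) with 0 ≤? N
... | yes _   = refl
... | no 0≰N = contradiction z≤n 0≰N

lucasF-fuel : ∀ N f g m → m ≤ f → m ≤ g → lucasF f N m ≡ lucasF g N m
lucasF-fuel N zero    g       zero z≤n _   = sym (lucasF-zero N g)
lucasF-fuel N (suc f) zero    zero _   z≤n = lucasF-zero N (suc f)
lucasF-fuel N (suc f) (suc g) m    m≤f m≤g with m ≤? N
... | yes _ = refl
... | no _  = cong sum (trans (sym (map-∘ (upTo N)))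
  (trans (map-cong (λ i → lucasF-fuel N f g (m ∸ suc i) (∸-mono m≤f (s≤s z≤n)) (∸-mono m≤g (s≤s z≤n))) (upTo N))
         (map-∘ (upTo N))))

L-≤ : ∀ n m → m ≤ suc n → L (suc n) m ≡ 2 ^ m ∸ 1
L-≤ n zero    _   = refl
L-≤ n (suc m) m≤N with suc m ≤? suc n
... | yes _   = refl
... | no m≰N = contradiction m≤N m≰N

L-rec : ∀ n k → L (suc n) (suc (suc n + k)) ≡ ∑[ i < suc n ] L (suc n) (suc n + k ∸ i)
L-rec n k with suc (suc n + k) ≤? suc n
... | yes M≤N = contradiction M≤N (<⇒≱ (s≤s (m≤m+n (suc n) k)))
... | no _    = begin
    sum (map (λ j → lucasF M N (suc M ∸ j)) (map suc (upTo N)))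
  ≡⟨ cong sum (sym (map-∘ (upTo N))) ⟩
    sum (map (λ i → lucasF M N (M ∸ i)) (upTo N))
  ≡⟨ cong sum (map-applyUpTo id (λ i → lucasF M N (M ∸ i)) N) ⟩
    ∑[ i < N ] lucasF M N (M ∸ i)
  ≡⟨ ∑-cong N (λ i _ → lucasF-fuel N M (M ∸ i) (M ∸ i) (m∸n≤m M i) ≤-refl) ⟩
    ∑[ i < N ] L N (M ∸ i)
  ∎
  where
    N = suc n
    M = suc n + k

L-unique : ∀ n (c : ℕ → ℕ) →
  (∀ m → m ≤ suc n → c m ≡ 2 ^ m ∸ 1) →
  (∀ k → c (suc (suc n + k)) ≡ ∑[ i < suc n ] c (suc n + k ∸ i)) →
  ∀ m → 1 ≤ m → c m ≡ L (suc n) m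
L-unique n c initial recurrence = <-rec _ step
  where
    step : ∀ m → (∀ {j} → j < m → 1 ≤ j → c j ≡ L (suc n) j) → 1 ≤ m → c m ≡ L (suc n) m
    step m ih 1≤m with m ≤? suc n
    ... | yes m≤N = trans (initial m m≤N) (sym (L-≤ n m m≤N))
    ... | no m≰N with m≤n⇒∃[o]m+o≡n (≰⇒> m≰N)
    ...   | k , refl = begin
        c (suc (suc n + k))
      ≡⟨ recurrence k ⟩
        ∑[ i < suc n ] c (suc n + k ∸ i)
      ≡⟨ ∑-cong (suc n) (λ i i<N → ih (s≤s (m∸n≤m (suc n + k) i)) (positive i i<N)) ⟩
        ∑[ i < suc n ] L (suc n) (suc n + k ∸ i)
      ≡⟨ sym (L-rec n k) ⟩
        L (suc n) (suc (suc n + k))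
      ∎
      where
        positive : ∀ i → i < suc n → 1 ≤ suc n + k ∸ i
        positive i i<N = m<n⇒0<n∸m (≤-trans i<N (m≤m+n (suc n) k))

sumWords : (k : ℕ) → (X k → ℕ) → ℕ
sumWords zero    f = f []
sumWords (suc k) f = sumWords k (λ v → f (y ∷ v)) + sumWords k (λ v → f (z ∷ v))

sumWords-cong : ∀ k {f g : X k → ℕ} → (∀ v → f v ≡ g v) → sumWords k f ≡ sumWords k g
sumWords-cong zero    eq = eq []
sumWords-cong (suc k) eq = cong₂ _+_ (sumWords-cong k (eq ∘ (y ∷_))) (sumWords-cong k (eq ∘ (z ∷_)))

sumWords-distrib-+ : ∀ k (f g : X k → ℕ) → sumWords k (λ v → f v + g v) ≡ sumWords k f + sumWords k g
sumWords-distrib-+ zero    f g = refl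
sumWords-distrib-+ (suc k) f g = trans
  (cong₂ _+_ (sumWords-distrib-+ k (f ∘ (y ∷_)) (g ∘ (y ∷_))) (sumWords-distrib-+ k (f ∘ (z ∷_)) (g ∘ (z ∷_))))
  (interchange +-commutativeSemigroup (sumWords k (f ∘ (y ∷_))) (sumWords k (g ∘ (y ∷_)))
                                      (sumWords k (f ∘ (z ∷_))) (sumWords k (g ∘ (z ∷_))))

sumWords-zero : ∀ k → sumWords k (λ _ → 0) ≡ 0
sumWords-zero zero    = refl
sumWords-zero (suc k) = cong₂ _+_ (sumWords-zero k) (sumWords-zero k)

sumWords-one : ∀ k → sumWords k (λ _ → 1) ≡ 2 ^ k
sumWords-one zero    = refl
sumWords-one (suc k) = cong₂ _+_ (sumWords-one k) (trans (sumWords-one k) (sym (+-identityʳ (2 ^ k))))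

sumWords-++ : ∀ m r (f : X (m + r) → ℕ) → sumWords (m + r) f ≡ sumWords m (λ w → sumWords r (λ s → f (w ++ s)))
sumWords-++ zero    r f = refl
sumWords-++ (suc m) r f = cong₂ _+_ (sumWords-++ m r (f ∘ (y ∷_))) (sumWords-++ m r (f ∘ (z ∷_)))

sumWords-single : ∀ r (g : X r → Bool) s₀ →
  sumWords r (λ s → boolToℕ (g s ∧ does (≡-dec _≟S_ s s₀))) ≡ boolToℕ (g s₀)
sumWords-single zero    g []       = cong boolToℕ (∧-identityʳ (g []))
sumWords-single (suc r) g (y ∷ s₀) = begin
    sumWords r (λ s → boolToℕ (g (y ∷ s) ∧ does (≡-dec _≟S_ s s₀)))
      + sumWords r (λ s → boolToℕ (g (z ∷ s) ∧ false))
  ≡⟨ cong₂ _+_ (sumWords-single r (g ∘ (y ∷_)) s₀)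
               (trans (sumWords-cong r (λ s → cong boolToℕ (∧-zeroʳ (g (z ∷ s))))) (sumWords-zero r)) ⟩
    boolToℕ (g (y ∷ s₀)) + 0
  ≡⟨ +-identityʳ _ ⟩
    boolToℕ (g (y ∷ s₀))
  ∎
sumWords-single (suc r) g (z ∷ s₀) = cong₂ _+_
  (trans (sumWords-cong r (λ s → cong boolToℕ (∧-zeroʳ (g (y ∷ s))))) (sumWords-zero r))
  (sumWords-single r (g ∘ (z ∷_)) s₀)

sum-map-concatMap : ∀ {A B : Set} (f : B → ℕ) (d : A → List B) xs →
  sum (map f (concatMap d xs)) ≡ sum (map (λ x → sum (map f (d x))) xs)
sum-map-concatMap f d []       = refl
sum-map-concatMap f d (x ∷ xs) = begin
    sum (map f (d x ++ᴸ concatMap d xs))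
  ≡⟨ cong sum (map-++ f (d x) (concatMap d xs)) ⟩
    sum (map f (d x) ++ᴸ map f (concatMap d xs))
  ≡⟨ sum-++ (map f (d x)) _ ⟩
    sum (map f (d x)) + sum (map f (concatMap d xs))
  ≡⟨ cong (sum (map f (d x)) +_) (sum-map-concatMap f d xs) ⟩
    sum (map f (d x)) + sum (map (λ x → sum (map f (d x))) xs)
  ∎

sum-map-allX : ∀ k (f : X k → ℕ) → sum (map f (allX k)) ≡ sumWords k f
sum-map-allX zero    f = +-identityʳ (f [])
sum-map-allX (suc k) f = begin
    sum (map f (concatMap (λ v → (y ∷ v) ∷ (z ∷ v) ∷ []) (allX k)))
  ≡⟨ sum-map-concatMap f _ (allX k) ⟩
    sum (map (λ v → f (y ∷ v) + (f (z ∷ v) + 0)) (allX k))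
  ≡⟨ sum-map-allX k _ ⟩
    sumWords k (λ v → f (y ∷ v) + (f (z ∷ v) + 0))
  ≡⟨ sumWords-cong k (λ v → cong (f (y ∷ v) +_) (+-identityʳ (f (z ∷ v)))) ⟩
    sumWords k (λ v → f (y ∷ v) + f (z ∷ v))
  ≡⟨ sumWords-distrib-+ k _ _ ⟩
    sumWords (suc k) f
  ∎

length-filter : ∀ {A : Set} {ℓ} {P : Pred A ℓ} (P? : Decidable P) xs →
  length (filter P? xs) ≡ sum (map (boolToℕ ∘ does ∘ P?) xs)
length-filter P? []       = refl
length-filter P? (x ∷ xs) with does (P? x)
... | true  = cong suc (length-filter P? xs)
... | false = length-filter P? xs

module RunFree (n : ℕ) where

  -- runFree r v: the word z^r v followed by a y has no run of n z's.
  runFree : ∀ {k} → ℕ → X k → Bool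
  runFree r []      = r <ᵇ n
  runFree r (y ∷ v) = (r <ᵇ n) ∧ runFree 0 v
  runFree r (z ∷ v) = runFree (suc r) v

  -- cyclicRunFree a v: the cyclic word z^a v has a y and no run of n z's; for v = y t it is
  -- tested on the rotation t z^a, which is followed by that y.
  cyclicRunFree : ∀ {k} → ℕ → X k → Bool
  cyclicRunFree a []      = false
  cyclicRunFree a (y ∷ t) = runFree 0 (t ++ replicate a z)
  cyclicRunFree a (z ∷ v) = cyclicRunFree (suc a) v

  runFreeCount : ℕ → ℕ → ℕ → ℕ
  runFreeCount zero    r a = boolToℕ (r + a <ᵇ n)
  runFreeCount (suc k) r a = (if r <ᵇ n then runFreeCount k 0 a else 0) + runFreeCount k (suc r) a

  cyclicRunFreeCount : ℕ → ℕ → ℕ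
  cyclicRunFreeCount zero    a = 0
  cyclicRunFreeCount (suc k) a = runFreeCount k 0 a + cyclicRunFreeCount k (suc a)

  runFree-replicate : ∀ r a → runFree r (replicate a z) ≡ (r + a <ᵇ n)
  runFree-replicate r zero    = cong (_<ᵇ n) (sym (+-identityʳ r))
  runFree-replicate r (suc a) = trans (runFree-replicate (suc r) a) (cong (_<ᵇ n) (sym (+-suc r a)))

  sumWords-runFree : ∀ k r a → sumWords k (λ t → boolToℕ (runFree r (t ++ replicate a z))) ≡ runFreeCount k r a
  sumWords-runFree zero    r a = cong boolToℕ (runFree-replicate r a)
  sumWords-runFree (suc k) r a with r <ᵇ n
  ... | true  = cong₂ _+_ (sumWords-runFree k 0 a) (sumWords-runFree k (suc r) a)
  ... | false = cong₂ _+_ (sumWords-zero k) (sumWords-runFree k (suc r) a)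

  sumWords-cyclicRunFree : ∀ k a → sumWords k (λ w → boolToℕ (cyclicRunFree a w)) ≡ cyclicRunFreeCount k a
  sumWords-cyclicRunFree zero    a = refl
  sumWords-cyclicRunFree (suc k) a = cong₂ _+_ (sumWords-runFree k 0 a) (sumWords-cyclicRunFree k (suc a))

  runFreeCount-≥ : ∀ k r a → n ≤ a → runFreeCount k r a ≡ 0
  runFreeCount-≥ zero    r a n≤a = cong boolToℕ (≥⇒<ᵇ≡false (≤-trans n≤a (m≤n+m a r)))
  runFreeCount-≥ (suc k) r a n≤a = cong₂ _+_
    (trans (cong (λ c → if r <ᵇ n then c else 0) (runFreeCount-≥ k 0 a n≤a)) (if-eta (r <ᵇ n)))
    (runFreeCount-≥ k (suc r) a n≤a)

  runFreeCount-short : ∀ k r a → r + k + a < n → runFreeCount k r a ≡ 2 ^ k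
  runFreeCount-short zero    r a r+a<n = cong boolToℕ (<⇒<ᵇ≡true (subst (λ x → x + a < n) (+-identityʳ r) r+a<n))
  runFreeCount-short (suc k) r a r+k+a<n = cong₂ _+_
    (trans (if-true (<⇒<ᵇ≡true r<n)) (runFreeCount-short k 0 a k+a<n))
    (trans (runFreeCount-short k (suc r) a r+1+k+a<n) (sym (+-identityʳ (2 ^ k))))
    where
      r+1+k+a<n : suc r + k + a < n
      r+1+k+a<n = subst (λ x → x + a < n) (+-suc r k) r+k+a<n
      r<n : r < n
      r<n = ≤-<-trans (≤-trans (m≤m+n r (suc k)) (m≤m+n (r + suc k) a)) r+k+a<n
      k+a<n : k + a < n
      k+a<n = ≤-<-trans (+-monoˡ-≤ a (m≤n+m k r)) (<-trans (n<1+n (r + k + a)) r+1+k+a<n)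

  cyclicRunFreeCount-short : ∀ k a → k + a ≤ n → cyclicRunFreeCount k a + 1 ≡ 2 ^ k
  cyclicRunFreeCount-short zero    a _       = refl
  cyclicRunFreeCount-short (suc k) a k+a<n = begin
      runFreeCount k 0 a + cyclicRunFreeCount k (suc a) + 1
    ≡⟨ +-assoc (runFreeCount k 0 a) _ 1 ⟩
      runFreeCount k 0 a + (cyclicRunFreeCount k (suc a) + 1)
    ≡⟨ cong₂ _+_ (runFreeCount-short k 0 a k+a<n)
                 (cyclicRunFreeCount-short k (suc a) (subst (_≤ n) (sym (+-suc k a)) k+a<n)) ⟩
      2 ^ k + 2 ^ k
    ≡⟨ cong (2 ^ k +_) (sym (+-identityʳ (2 ^ k))) ⟩
      2 ^ suc k
    ∎

  runFreeCount-unfold : ∀ j r a → runFreeCount j r a ≡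
    ∑[ i < j ] (if r + i <ᵇ n then runFreeCount (j ∸ suc i) 0 a else 0) + boolToℕ (r + j + a <ᵇ n)
  runFreeCount-unfold zero    r a = cong (λ x → boolToℕ (x + a <ᵇ n)) (sym (+-identityʳ r))
  runFreeCount-unfold (suc j) r a = begin
      first + runFreeCount j (suc r) a
    ≡⟨ cong (first +_) (runFreeCount-unfold j (suc r) a) ⟩
      first + (∑[ i < j ] (if suc r + i <ᵇ n then runFreeCount (j ∸ suc i) 0 a else 0)
                + boolToℕ (suc r + j + a <ᵇ n))
    ≡⟨ +-assoc first _ _ ⟨
      first + ∑[ i < j ] (if suc r + i <ᵇ n then runFreeCount (j ∸ suc i) 0 a else 0)
        + boolToℕ (suc r + j + a <ᵇ n)
    ≡⟨ cong₂ _+_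
         (cong₂ _+_ (cong (λ x → if x <ᵇ n then runFreeCount j 0 a else 0) (sym (+-identityʳ r)))
                    (∑-cong j (λ i _ → cong (λ x → if x <ᵇ n then runFreeCount (j ∸ suc i) 0 a else 0)
                                            (sym (+-suc r i)))))
         (cong (λ x → boolToℕ (x + a <ᵇ n)) (sym (+-suc r j))) ⟩
      ∑[ i < suc j ] (if r + i <ᵇ n then runFreeCount (suc j ∸ suc i) 0 a else 0)
        + boolToℕ (r + suc j + a <ᵇ n)
    ∎
    where
      first = if r <ᵇ n then runFreeCount j 0 a else 0

  runFreeCount-rec : ∀ K b → n ≤ K + b →
    runFreeCount K 0 b ≡ ∑[ i < n ] (if i <ᵇ K then runFreeCount (K ∸ suc i) 0 b else 0)
  runFreeCount-rec K b n≤K+b = begin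
      runFreeCount K 0 b                     ≡⟨ runFreeCount-unfold K 0 b ⟩
      byFirstY + boolToℕ (K + b <ᵇ n)        ≡⟨ cong (byFirstY +_) (cong boolToℕ (≥⇒<ᵇ≡false n≤K+b)) ⟩
      byFirstY + 0                           ≡⟨ +-identityʳ byFirstY ⟩
      byFirstY                               ≡⟨ ∑-truncate K n (λ i → runFreeCount (K ∸ suc i) 0 b) ⟩
      ∑[ i < n ] (if i <ᵇ K then runFreeCount (K ∸ suc i) 0 b else 0)
    ∎
    where
      byFirstY = ∑[ i < K ] (if i <ᵇ n then runFreeCount (K ∸ suc i) 0 b else 0)

  cyclicRunFreeCount-unfold : ∀ j a → cyclicRunFreeCount j a ≡ ∑[ i < j ] runFreeCount (j ∸ suc i) 0 (a + i)
  cyclicRunFreeCount-unfold zero    a = refl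
  cyclicRunFreeCount-unfold (suc j) a = cong₂ _+_
    (cong (runFreeCount j 0) (sym (+-identityʳ a)))
    (trans (cyclicRunFreeCount-unfold j (suc a))
           (∑-cong j (λ i _ → cong (runFreeCount (j ∸ suc i) 0) (sym (+-suc a i)))))

  cyclicRunFreeCount-byFirstY : ∀ M →
    cyclicRunFreeCount M 0 ≡ ∑[ i < n ] (if i <ᵇ M then runFreeCount (M ∸ suc i) 0 i else 0)
  cyclicRunFreeCount-byFirstY M = begin
      cyclicRunFreeCount M 0
    ≡⟨ cyclicRunFreeCount-unfold M 0 ⟩
      ∑[ i < M ] runFreeCount (M ∸ suc i) 0 i
    ≡⟨ ∑-cong M (λ i _ → vanishes-≥n i) ⟩
      ∑[ i < M ] (if i <ᵇ n then runFreeCount (M ∸ suc i) 0 i else 0)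
    ≡⟨ ∑-truncate M n _ ⟩
      ∑[ i < n ] (if i <ᵇ M then runFreeCount (M ∸ suc i) 0 i else 0)
    ∎
    where
      vanishes-≥n : ∀ i → runFreeCount (M ∸ suc i) 0 i ≡ (if i <ᵇ n then runFreeCount (M ∸ suc i) 0 i else 0)
      vanishes-≥n i with i <? n
      ... | yes i<n = sym (if-true (<⇒<ᵇ≡true i<n))
      ... | no i≮n  = trans (runFreeCount-≥ (M ∸ suc i) 0 i (≮⇒≥ i≮n))
                            (sym (if-false (≥⇒<ᵇ≡false (≮⇒≥ i≮n))))

  -- Split by the z-block before the first y (length i) and the one after it (length j);
  -- swapping the two sums regroups the terms into cyclic counts of shorter length.
  cyclicRunFreeCount-rec : ∀ k → cyclicRunFreeCount (suc (n + k)) 0 ≡ ∑[ j < n ] cyclicRunFreeCount (n + k ∸ j) 0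
  cyclicRunFreeCount-rec k = begin
      cyclicRunFreeCount (suc N) 0
    ≡⟨ cyclicRunFreeCount-byFirstY (suc N) ⟩
      ∑[ i < n ] (if i <ᵇ suc N then runFreeCount (N ∸ i) 0 i else 0)
    ≡⟨ ∑-cong n (λ i i<n → trans (if-true (<⇒<ᵇ≡true (≤-trans i<n (≤-trans (m≤m+n n k) (n≤1+n N)))))
                                  (runFreeCount-rec (N ∸ i) i (long i i<n))) ⟩
      ∑[ i < n ] ∑[ j < n ] (if j <ᵇ N ∸ i then runFreeCount (N ∸ i ∸ suc j) 0 i else 0)
    ≡⟨ ∑-comm n n _ ⟩
      ∑[ j < n ] ∑[ i < n ] (if j <ᵇ N ∸ i then runFreeCount (N ∸ i ∸ suc j) 0 i else 0)
    ≡⟨ ∑-cong n (λ j _ → ∑-cong n (λ i _ →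
         cong₂ (λ b x → if b then runFreeCount x 0 i else 0) (<ᵇ-∸-swap j i N) (∸-suc-swap N i j))) ⟩
      ∑[ j < n ] ∑[ i < n ] (if i <ᵇ N ∸ j then runFreeCount (N ∸ j ∸ suc i) 0 i else 0)
    ≡⟨ ∑-cong n (λ j _ → sym (cyclicRunFreeCount-byFirstY (N ∸ j))) ⟩
      ∑[ j < n ] cyclicRunFreeCount (N ∸ j) 0
    ∎
    where
      N = n + k
      long : ∀ i → i < n → n ≤ N ∸ i + i
      long i i<n = subst (n ≤_) (sym (m∸n+n≡m (≤-trans (<⇒≤ i<n) (m≤m+n n k)))) (m≤m+n n k)

cyclicRunFreeCount≡L : ∀ n m → 1 ≤ m → RunFree.cyclicRunFreeCount (suc n) m 0 ≡ L (suc n) m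
cyclicRunFreeCount≡L n = L-unique n (λ m → cyclicRunFreeCount m 0) short cyclicRunFreeCount-rec
  where
    open RunFree (suc n)
    short : ∀ m → m ≤ suc n → cyclicRunFreeCount m 0 ≡ 2 ^ m ∸ 1
    short m m≤N = begin
      cyclicRunFreeCount m 0           ≡⟨ m+n∸n≡m _ 1 ⟨
      cyclicRunFreeCount m 0 + 1 ∸ 1   ≡⟨ cong (_∸ 1) (cyclicRunFreeCount-short m 0 m+0≤N) ⟩
      2 ^ m ∸ 1                        ∎
      where
        m+0≤N : m + 0 ≤ suc n
        m+0≤N = subst (_≤ suc n) (sym (+-identityʳ m)) m≤N

-- Positions past the end read as y, so a word behaves as if followed by a y.
_!_ : ∀ {k} → X k → ℕ → Sym
[]      ! j     = y
(x ∷ v) ! zero  = x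
(x ∷ v) ! suc j = v ! j

lookup-! : ∀ {k} (v : X k) (i : Fin k) → lookup v i ≡ v ! toℕ i
lookup-! (x ∷ v) fzero    = refl
lookup-! (x ∷ v) (fsuc i) = lookup-! v i

!-tabulate : ∀ {k} (f : Fin k → Sym) {j} (j<k : j < k) → tabulate f ! j ≡ f (fromℕ< j<k)
!-tabulate f {j} j<k = begin
    tabulate f ! j                      ≡⟨ cong (tabulate f !_) (toℕ-fromℕ< j<k) ⟨
    tabulate f ! toℕ (fromℕ< j<k)       ≡⟨ lookup-! (tabulate f) (fromℕ< j<k) ⟨
    lookup (tabulate f) (fromℕ< j<k)    ≡⟨ lookup∘tabulate f (fromℕ< j<k) ⟩
    f (fromℕ< j<k)                      ∎

!-ext : ∀ {k} (v w : X k) → (∀ j → j < k → v ! j ≡ w ! j) → v ≡ w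
!-ext []      []      _  = refl
!-ext (x ∷ v) (x′ ∷ w) eq = cong₂ _∷_ (eq 0 z<s) (!-ext v w (λ j j<k → eq (suc j) (s<s j<k)))

!-++ˡ : ∀ {m r} (w : X m) (s : X r) {j} → j < m → (w ++ s) ! j ≡ w ! j
!-++ˡ (x ∷ w) s {zero}  _         = refl
!-++ˡ (x ∷ w) s {suc j} (s<s j<m) = !-++ˡ w s j<m

!-++ʳ : ∀ {m r} (w : X m) (s : X r) j → (w ++ s) ! (m + j) ≡ s ! j
!-++ʳ []      s j = refl
!-++ʳ (x ∷ w) s j = !-++ʳ w s j

!-≥ : ∀ {k} (v : X k) {j} → k ≤ j → v ! j ≡ y
!-≥ []      _         = refl
!-≥ (x ∷ v) (s≤s k≤j) = !-≥ v k≤j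

!-replicate : ∀ {a j} → j < a → replicate a z ! j ≡ z
!-replicate {suc a} {zero}  _         = refl
!-replicate {suc a} {suc j} (s<s j<a) = !-replicate j<a

!-replicate-∷ : ∀ {k} r (v : X k) j → (replicate r z ++ z ∷ v) ! j ≡ (replicate (suc r) z ++ v) ! j
!-replicate-∷ zero    v j       = refl
!-replicate-∷ (suc r) v zero    = refl
!-replicate-∷ (suc r) v (suc j) = !-replicate-∷ r v j

module Runs (n : ℕ) where
  open RunFree n

  HasRun : (ℕ → Sym) → Set
  HasRun h = Σ[ i ∈ ℕ ] (∀ k → k < n → h (i + k) ≡ z)

  HasRun-cong : ∀ {g h} → (∀ j → g j ≡ h j) → HasRun g → HasRun h
  HasRun-cong g≡h (i , run) = i , λ k k<n → trans (sym (g≡h (i + k))) (run k k<n)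

  y-blocks-run : ∀ h {p} i → h p ≡ y → i ≤ p → p < i + n → ¬ (∀ k → k < n → h (i + k) ≡ z)
  y-blocks-run h {p} i hp≡y i≤p p<i+n run =
    contradiction (trans (sym hp≡y) (trans (cong h (sym i+[p∸i]≡p)) (run (p ∸ i) p∸i<n))) λ ()
    where
      i+[p∸i]≡p : i + (p ∸ i) ≡ p
      i+[p∸i]≡p = m+[n∸m]≡n i≤p
      p∸i<n : p ∸ i < n
      p∸i<n = +-cancelˡ-< i (p ∸ i) n (subst (_< i + n) (sym i+[p∸i]≡p) p<i+n)

  zeros-run : ∀ {k} r (v : X k) → n ≤ r → HasRun ((replicate r z ++ v) !_)
  zeros-run r v n≤r = 0 , λ k k<n → trans (!-++ˡ (replicate r z) v (≤-trans k<n n≤r)) (!-replicate (≤-trans k<n n≤r))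

  run-after-zeros : ∀ {k} r (v : X k) → v ! 0 ≡ y → r < n → HasRun ((replicate r z ++ v) !_) →
    Σ[ o ∈ ℕ ] (∀ k → k < n → v ! suc (o + k) ≡ z)
  run-after-zeros r v v₀≡y r<n (i , run) with i ≤? r
  ... | yes i≤r = contradiction run (y-blocks-run ((replicate r z ++ v) !_) i y-at-r i≤r (≤-trans r<n (m≤n+m n i)))
    where
      y-at-r : (replicate r z ++ v) ! r ≡ y
      y-at-r = trans (cong ((replicate r z ++ v) !_) (sym (+-identityʳ r))) (trans (!-++ʳ (replicate r z) v 0) v₀≡y)
  ... | no i≰r with m≤n⇒∃[o]m+o≡n (≰⇒> i≰r)
  ...   | o , refl = o , λ k k<n → trans (sym (!-++ʳ (replicate r z) v (suc (o + k))))
                                            (trans (cong ((replicate r z ++ v) !_) (reassoc k)) (run k k<n))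
    where
      reassoc : ∀ k → r + suc (o + k) ≡ suc r + o + k
      reassoc k = trans (+-suc r (o + k)) (cong suc (sym (+-assoc r o k)))

  ¬runFree⇒HasRun : ∀ {k} r (v : X k) → runFree r v ≡ false → HasRun ((replicate r z ++ v) !_)
  ¬runFree⇒HasRun r []      eq = zeros-run r [] (<ᵇ≡false⇒≥ r n eq)
  ¬runFree⇒HasRun r (z ∷ v) eq =
    HasRun-cong (λ j → sym (!-replicate-∷ r v j)) (¬runFree⇒HasRun (suc r) v eq)
  ¬runFree⇒HasRun r (y ∷ v) eq with r <ᵇ n in r<ᵇn
  ... | false = zeros-run r (y ∷ v) (<ᵇ≡false⇒≥ r n r<ᵇn)
  ... | true with ¬runFree⇒HasRun 0 v eq
  ...   | i , run = r + suc i , λ k k<n → trans (cong ((replicate r z ++ y ∷ v) !_) (+-assoc r (suc i) k))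
                                                (trans (!-++ʳ (replicate r z) (y ∷ v) (suc (i + k))) (run k k<n))

  HasRun⇒¬runFree : 0 < n → ∀ {k} r (v : X k) → HasRun ((replicate r z ++ v) !_) → runFree r v ≡ false
  HasRun⇒¬runFree 0<n r (z ∷ v) run =
    HasRun⇒¬runFree 0<n (suc r) v (HasRun-cong (!-replicate-∷ r v) run)
  HasRun⇒¬runFree 0<n r [] run with r <? n
  ... | no r≮n  = ≥⇒<ᵇ≡false (≮⇒≥ r≮n)
  ... | yes r<n with run-after-zeros r [] refl r<n run
  ...   | _ , run′ = contradiction (run′ 0 0<n) λ ()
  HasRun⇒¬runFree 0<n r (y ∷ v) run with r <? n
  ... | no r≮n  = cong (_∧ runFree 0 v) (≥⇒<ᵇ≡false (≮⇒≥ r≮n))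
  ... | yes r<n = trans (cong (_∧ runFree 0 v) (<⇒<ᵇ≡true r<n))
                        (HasRun⇒¬runFree 0<n 0 v (run-after-zeros r (y ∷ v) refl r<n run))

[m+n%d]%d≡[m+n]%d : ∀ m n d .{{_ : NonZero d}} → (m + n % d) % d ≡ (m + n) % d
[m+n%d]%d≡[m+n]%d m n d = begin
    (m + n % d) % d             ≡⟨ %-distribˡ-+ m (n % d) d ⟩
    (m % d + n % d % d) % d     ≡⟨ cong (λ x → (m % d + x) % d) (m%n%n≡m%n n d) ⟩
    (m % d + n % d) % d         ≡⟨ %-distribˡ-+ m n d ⟨
    (m + n) % d                 ∎

cycle : (m : ℕ) .{{_ : NonZero m}} → (ℕ → Sym) → ℕ → Sym
cycle m f j = f (j % m)

module PeriodicRuns (n : ℕ) (0<n : 0 < n) (m : ℕ) .{{_ : NonZero m}} (f : ℕ → Sym) where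
  open RunFree n
  open Runs n

  h : ℕ → Sym
  h = cycle m f

  h-+m : ∀ j → h (j + m) ≡ h j
  h-+m j = cong f ([m+n]%n≡m%n j m)

  module FirstY {k} (a : ℕ) (t : X k) (a+1+k≡m : a + suc k ≡ m)
                (h-zeros : ∀ j → j < a → h j ≡ z) (h-word : ∀ j → j < suc k → h (a + j) ≡ (y ∷ t) ! j) where

    V : X (k + a)
    V = t ++ replicate a z

    h-y : h a ≡ y
    h-y = trans (cong h (sym (+-identityʳ a))) (h-word 0 z<s)

    h-V : ∀ j → j < k + a → h (a + suc j) ≡ V ! j
    h-V j j<k+a with j <? k
    ... | yes j<k = trans (h-word (suc j) (s<s j<k)) (sym (!-++ˡ t (replicate a z) j<k))
    ... | no j≮k with m≤n⇒∃[o]m+o≡n (≮⇒≥ j≮k)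
    ...   | j′ , refl = begin
        h (a + suc (k + j′))  ≡⟨ cong h wrap ⟩
        h (j′ + m)            ≡⟨ h-+m j′ ⟩
        h j′                  ≡⟨ h-zeros j′ j′<a ⟩
        z                     ≡⟨ !-replicate j′<a ⟨
        replicate a z ! j′    ≡⟨ !-++ʳ t (replicate a z) j′ ⟨
        V ! (k + j′)          ∎
      where
        j′<a : j′ < a
        j′<a = +-cancelˡ-< k j′ a j<k+a
        wrap : a + suc (k + j′) ≡ j′ + m
        wrap = trans (solve 3 (λ a k j′ → a :+ (con 1 :+ (k :+ j′)) := j′ :+ (a :+ (con 1 :+ k))) refl a k j′)
                     (cong (j′ +_) a+1+k≡m)

    m≡1+k+a : m ≡ suc (k + a)
    m≡1+k+a = trans (sym a+1+k≡m) (trans (+-suc a k) (cong suc (+-comm a k)))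

    -- A run starting at i is seen in V, which begins at position a + 1, as starting at i′.
    module Shifted (i : ℕ) where
      i′ : ℕ
      i′ = (i + k) % m

      same-residue : ∀ k′ → h (a + suc (i′ + k′)) ≡ h (i + k′)
      same-residue k′ = cong f (begin
          (a + suc (i′ + k′)) % m
            ≡⟨ cong (_% m) (solve 3 (λ a i′ k′ → a :+ (con 1 :+ (i′ :+ k′)) := (a :+ (con 1 :+ k′)) :+ i′) refl a i′ k′) ⟩
          (a + suc k′ + i′) % m         ≡⟨ [m+n%d]%d≡[m+n]%d (a + suc k′) (i + k) m ⟩
          (a + suc k′ + (i + k)) % m    ≡⟨ cong (_% m) rearrange ⟩
          (i + k′ + m) % m              ≡⟨ [m+n]%n≡m%n (i + k′) m ⟩
          (i + k′) % m                  ∎)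
        where
          rearrange : a + suc k′ + (i + k) ≡ i + k′ + m
          rearrange = trans
            (solve 4 (λ a k i k′ → (a :+ (con 1 :+ k′)) :+ (i :+ k) := (i :+ k′) :+ (a :+ (con 1 :+ k))) refl a k i k′)
            (cong (i + k′ +_) a+1+k≡m)

    HasRun-h⇒HasRun-V : HasRun h → HasRun (V !_)
    HasRun-h⇒HasRun-V (i , run) with Shifted.i′ i + n ≤? k + a
    ... | yes fits = i′ , λ k′ k′<n →
      trans (sym (h-V (i′ + k′) (<-≤-trans (+-monoʳ-< i′ k′<n) fits))) (trans (same-residue k′) (run k′ k′<n))
      where open Shifted i
    -- Otherwise the run reaches position a + m, which holds the y.
    ... | no overflows = contradiction
      (trans (sym h-y) (trans (sym (h-+m a)) (trans (cong h reaches-y) (trans (same-residue k′) (run k′ k′<n))))) λ ()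
      where
        open Shifted i
        i′≤k+a : i′ ≤ k + a
        i′≤k+a = s≤s⁻¹ (subst (i′ <_) m≡1+k+a (m%n<n (i + k) m))
        k′ : ℕ
        k′ = k + a ∸ i′
        k′<n : k′ < n
        k′<n = +-cancelˡ-< i′ k′ n (subst (_< i′ + n) (sym (m+[n∸m]≡n i′≤k+a)) (≰⇒> overflows))
        reaches-y : a + m ≡ a + suc (i′ + k′)
        reaches-y = cong (a +_) (trans m≡1+k+a (cong suc (sym (m+[n∸m]≡n i′≤k+a))))

    HasRun-V⇒HasRun-h : HasRun (V !_) → HasRun h
    HasRun-V⇒HasRun-h (i , run) = a + suc i , λ k′ k′<n →
      trans (cong h (+-assoc a (suc i) k′)) (trans (h-V (i + k′) (inside k′ k′<n)) (run k′ k′<n))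
      where
        inside : ∀ k′ → k′ < n → i + k′ < k + a
        inside k′ k′<n with i + k′ <? k + a
        ... | yes i+k′<k+a = i+k′<k+a
        ... | no  i+k′≮k+a = contradiction (trans (sym (!-≥ V (≮⇒≥ i+k′≮k+a))) (run k′ k′<n)) λ ()

  cyclicRunFree⇔HasRun : ∀ {k} a (v : X k) → a + k ≡ m →
    (∀ j → j < a → h j ≡ z) → (∀ j → j < k → h (a + j) ≡ v ! j) → (cyclicRunFree a v ≡ false) ⇔ HasRun h
  cyclicRunFree⇔HasRun a [] a+0≡m h-zeros _ = mk⇔ (λ _ → 0 , λ j _ → all-z j) (λ _ → refl)
    where
      all-z : ∀ j → h j ≡ z
      all-z j = trans (cong f (sym (m%n%n≡m%n j m)))
                      (h-zeros (j % m) (subst (j % m <_) (trans (sym a+0≡m) (+-identityʳ a)) (m%n<n j m)))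
  cyclicRunFree⇔HasRun {suc k} a (z ∷ v) a+1+k≡m h-zeros h-word =
    cyclicRunFree⇔HasRun (suc a) v (trans (sym (+-suc a k)) a+1+k≡m) h-zeros′ h-word′
    where
      h-zeros′ : ∀ j → j < suc a → h j ≡ z
      h-zeros′ j (s≤s j≤a) with m≤n⇒m<n∨m≡n j≤a
      ... | inj₁ j<a  = h-zeros j j<a
      ... | inj₂ refl = trans (cong h (sym (+-identityʳ j))) (h-word 0 z<s)
      h-word′ : ∀ j → j < k → h (suc a + j) ≡ v ! j
      h-word′ j j<k = trans (cong h (sym (+-suc a j))) (h-word (suc j) (s<s j<k))
  cyclicRunFree⇔HasRun a (y ∷ t) a+1+k≡m h-zeros h-word =
    mk⇔ (HasRun-V⇒HasRun-h ∘ ¬runFree⇒HasRun 0 V) (HasRun⇒¬runFree 0<n 0 V ∘ HasRun-h⇒HasRun-V)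
    where open FirstY a t a+1+k≡m h-zeros h-word

does-⇔-≡false : ∀ {A : Set} {b} → A ⇔ (b ≡ false) → (a? : Dec A) → does a? ≡ not b
does-⇔-≡false {b = false} A⇔b≡false a? = dec-true a? (Equivalence.from A⇔b≡false refl)
does-⇔-≡false {b = true}  A⇔b≡false a? = dec-false a? (λ a → case Equivalence.to A⇔b≡false a of λ ())

module FixedWords (m′ r : ℕ) (m∣l : suc m′ ∣ suc m′ + r) where
  m l : ℕ
  m = suc m′
  l = m + r

  cycle-< : ∀ (w : X m) {j} → j < m → cycle m (w !_) j ≡ w ! j
  cycle-< w j<m = cong (w !_) (m<n⇒m%n≡m j<m)

  cycle-+m : ∀ (g : ℕ → Sym) j → cycle m g (j + m) ≡ cycle m g j
  cycle-+m g j = cong g ([m+n]%n≡m%n j m)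

  cycle-%l : ∀ (g : ℕ → Sym) j → cycle m g (j % l) ≡ cycle m g j
  cycle-%l g j = cong g (m∣n⇒o%n%m≡o%m m l j m∣l)

  periodicTail : X m → X r
  periodicTail w = tabulate (λ j → cycle m (w !_) (m + toℕ j))

  periodicWord : X m → X l
  periodicWord w = w ++ periodicTail w

  periodicWord-! : ∀ w {j} → j < l → periodicWord w ! j ≡ cycle m (w !_) j
  periodicWord-! w {j} j<l with j <? m
  ... | yes j<m = trans (!-++ˡ w _ j<m) (sym (cycle-< w j<m))
  ... | no j≮m with m≤n⇒∃[o]m+o≡n (≮⇒≥ j≮m)
  ...   | j′ , refl = trans (!-++ʳ w _ j′)
                            (trans (!-tabulate _ (+-cancelˡ-< m j′ r j<l))
                                   (cong (λ t → cycle m (w !_) (m + t)) (toℕ-fromℕ< _)))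

  lookup-mod : ∀ (u : X l) j → lookup u (j mod l) ≡ u ! (j % l)
  lookup-mod u j = trans (lookup-! u (j mod l)) (cong (u !_) (toℕ-fromℕ< (m%n<n j l)))

  lookup-periodicWord : ∀ w j → lookup (periodicWord w) (j mod l) ≡ cycle m (w !_) j
  lookup-periodicWord w j =
    trans (lookup-mod (periodicWord w) j) (trans (periodicWord-! w (m%n<n j l)) (cycle-%l (w !_) j))

  shift-! : ∀ u {j} → j < l → shift l m u ! j ≡ u ! ((j + m) % l)
  shift-! u {j} j<l = begin
      shift l m u ! j                         ≡⟨ cong (shift l m u !_) (toℕ-fromℕ< j<l) ⟨
      shift l m u ! toℕ (fromℕ< j<l)          ≡⟨ lookup-! (shift l m u) (fromℕ< j<l) ⟨
      lookup (shift l m u) (fromℕ< j<l)       ≡⟨ lookup∘tabulate (λ i → lookup u ((toℕ i + m) mod l)) (fromℕ< j<l) ⟩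
      lookup u ((toℕ (fromℕ< j<l) + m) mod l) ≡⟨ lookup-mod u (toℕ (fromℕ< j<l) + m) ⟩
      u ! ((toℕ (fromℕ< j<l) + m) % l)        ≡⟨ cong (λ t → u ! ((t + m) % l)) (toℕ-fromℕ< j<l) ⟩
      u ! ((j + m) % l)                       ∎

  ShiftInvariant : X l → Set
  ShiftInvariant u = ∀ i → i < l → u ! ((i + m) % l) ≡ u ! i

  shift≡⇔ShiftInvariant : ∀ u → shift l m u ≡ u ⇔ ShiftInvariant u
  shift≡⇔ShiftInvariant u = mk⇔
    (λ eq i i<l → trans (sym (shift-! u i<l)) (cong (_! i) eq))
    (λ inv → !-ext _ _ (λ j j<l → trans (shift-! u j<l) (inv j j<l)))

  ShiftInvariant-periodicWord : ∀ w → ShiftInvariant (periodicWord w)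
  ShiftInvariant-periodicWord w i i<l = begin
      periodicWord w ! ((i + m) % l)  ≡⟨ periodicWord-! w (m%n<n (i + m) l) ⟩
      cycle m (w !_) ((i + m) % l)    ≡⟨ cycle-%l (w !_) (i + m) ⟩
      cycle m (w !_) (i + m)          ≡⟨ cycle-+m (w !_) i ⟩
      cycle m (w !_) i                ≡⟨ periodicWord-! w i<l ⟨
      periodicWord w ! i              ∎

  ShiftInvariant-! : ∀ w s → ShiftInvariant (w ++ s) → ∀ j → j < l → (w ++ s) ! j ≡ cycle m (w !_) j
  ShiftInvariant-! w s inv = <-rec _ step
    where
      P : ℕ → Set
      P j = j < l → (w ++ s) ! j ≡ cycle m (w !_) j
      step : ∀ j → (∀ {i} → i < j → P i) → P j
      step j ih j<l with j <? m
      ... | yes j<m = trans (!-++ˡ w s j<m) (sym (cycle-< w j<m))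
      ... | no j≮m with m≤n⇒∃[o]m+o≡n (≮⇒≥ j≮m)
      ...   | i , refl = begin
          (w ++ s) ! (m + i)              ≡⟨ cong ((w ++ s) !_) i+m%l≡m+i ⟨
          (w ++ s) ! ((i + m) % l)        ≡⟨ inv i i<l ⟩
          (w ++ s) ! i                    ≡⟨ ih (s≤s (m≤n+m i m′)) i<l ⟩
          cycle m (w !_) i                ≡⟨ cycle-+m (w !_) i ⟨
          cycle m (w !_) (i + m)          ≡⟨ cong (cycle m (w !_)) (+-comm i m) ⟩
          cycle m (w !_) (m + i)          ∎
        where
          i<l : i < l
          i<l = ≤-<-trans (m≤n+m i m) j<l
          i+m%l≡m+i : (i + m) % l ≡ m + i
          i+m%l≡m+i = trans (m<n⇒m%n≡m (subst (_< l) (+-comm m i) j<l)) (+-comm i m)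

  shift≡⇔periodicTail : ∀ w s → shift l m (w ++ s) ≡ w ++ s ⇔ s ≡ periodicTail w
  shift≡⇔periodicTail w s = mk⇔
    (λ eq → !-ext s (periodicTail w) (λ j j<r → begin
        s ! j                             ≡⟨ !-++ʳ w s j ⟨
        (w ++ s) ! (m + j)                ≡⟨ ShiftInvariant-! w s (to (shift≡⇔ShiftInvariant _) eq) (m + j) (+-monoʳ-< m j<r) ⟩
        cycle m (w !_) (m + j)            ≡⟨ cong (λ t → cycle m (w !_) (m + t)) (toℕ-fromℕ< j<r) ⟨
        cycle m (w !_) (m + toℕ (fromℕ< j<r)) ≡⟨ !-tabulate _ j<r ⟨
        periodicTail w ! j                ∎))
    (λ { refl → from (shift≡⇔ShiftInvariant _) (ShiftInvariant-periodicWord w) })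
    where open Equivalence

  countFixed≡sumWords : ∀ n → countFixed l n m ≡ sumWords m (λ w → boolToℕ (does (hasZRun? l n (periodicWord w))))
  countFixed≡sumWords n = begin
      length (filter P? (allX l))
    ≡⟨ length-filter P? (allX l) ⟩
      sum (map (boolToℕ ∘ does ∘ P?) (allX l))
    ≡⟨ sum-map-allX l (boolToℕ ∘ does ∘ P?) ⟩
      sumWords (m + r) (boolToℕ ∘ does ∘ P?)
    ≡⟨ sumWords-++ m r (boolToℕ ∘ does ∘ P?) ⟩
      sumWords m (λ w → sumWords r (λ s →
        boolToℕ (does (hasZRun? l n (w ++ s)) ∧ does (≡-dec _≟S_ (shift l m (w ++ s)) (w ++ s)))))
    ≡⟨ sumWords-cong m (λ w → sumWords-cong r (λ s → cong (λ b → boolToℕ (does (hasZRun? l n (w ++ s)) ∧ b))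
         (does-⇔ (shift≡⇔periodicTail w s) (≡-dec _≟S_ _ _) (≡-dec _≟S_ s (periodicTail w))))) ⟩
      sumWords m (λ w → sumWords r (λ s → boolToℕ (does (hasZRun? l n (w ++ s)) ∧ does (≡-dec _≟S_ s (periodicTail w)))))
    ≡⟨ sumWords-cong m (λ w → sumWords-single r (λ s → does (hasZRun? l n (w ++ s))) (periodicTail w)) ⟩
      sumWords m (λ w → boolToℕ (does (hasZRun? l n (periodicWord w))))
    ∎
    where
      P? = λ u → hasZRun? l n u ×-dec ≡-dec _≟S_ (shift l m u) u

  cycle-%-+ : ∀ (g : ℕ → Sym) i j → cycle m g (i % m + j) ≡ cycle m g (i + j)
  cycle-%-+ g i j = cong g (begin
      (i % m + j) % m   ≡⟨ cong (_% m) (+-comm (i % m) j) ⟩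
      (j + i % m) % m   ≡⟨ [m+n%d]%d≡[m+n]%d j i m ⟩
      (j + i) % m       ≡⟨ cong (_% m) (+-comm j i) ⟩
      (i + j) % m       ∎)

  HasZRun⇔HasRun : ∀ n w → HasZRun l n (periodicWord w) ⇔ Runs.HasRun n (cycle m (w !_))
  HasZRun⇔HasRun n w = mk⇔
    (λ (i , run) → toℕ i , λ k k<n → begin
        c (toℕ i + k)                                   ≡⟨ cong (λ t → c (toℕ i + t)) (toℕ-fromℕ< k<n) ⟨
        c (toℕ i + toℕ (fromℕ< k<n))                    ≡⟨ lookup-periodicWord w (toℕ i + toℕ (fromℕ< k<n)) ⟨
        lookup u ((toℕ i + toℕ (fromℕ< k<n)) mod l)     ≡⟨ run (fromℕ< k<n) ⟩
        z                                               ∎)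
    (λ (i , run) → let i′ = fromℕ< (i%m<l i) in i′ , λ k → begin
        lookup u ((toℕ i′ + toℕ k) mod l)               ≡⟨ lookup-periodicWord w (toℕ i′ + toℕ k) ⟩
        c (toℕ i′ + toℕ k)                              ≡⟨ cong (λ t → c (t + toℕ k)) (toℕ-fromℕ< (i%m<l i)) ⟩
        c (i % m + toℕ k)                               ≡⟨ cycle-%-+ (w !_) i (toℕ k) ⟩
        c (i + toℕ k)                                   ≡⟨ run (toℕ k) (toℕ<n k) ⟩
        z                                               ∎)
    where
      u = periodicWord w
      c = cycle m (w !_)
      i%m<l : ∀ i → i % m < l
      i%m<l i = <-≤-trans (m%n<n i m) (m≤m+n m r)

  countFixed+L : ∀ n → countFixed l n m + L n m ≡ 2 ^ m
  countFixed+L zero = begin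
      countFixed l 0 m + 0                                                  ≡⟨ +-identityʳ _ ⟩
      countFixed l 0 m                                                      ≡⟨ countFixed≡sumWords 0 ⟩
      sumWords m (λ w → boolToℕ (does (hasZRun? l 0 (periodicWord w))))    ≡⟨ sumWords-cong m (λ w → cong boolToℕ (trivial w)) ⟩
      sumWords m (λ _ → 1)                                                  ≡⟨ sumWords-one m ⟩
      2 ^ m                                                                 ∎
    where
      trivial : ∀ w → does (hasZRun? l 0 (periodicWord w)) ≡ true
      trivial w = dec-true (hasZRun? l 0 (periodicWord w)) (fzero , λ ())
  countFixed+L (suc n) = begin
      countFixed l (suc n) m + L (suc n) m
    ≡⟨ cong₂ _+_ (trans (countFixed≡sumWords (suc n)) (sumWords-cong m (cong boolToℕ ∘ hasZRun≡not)))
                 (sym (trans (sumWords-cyclicRunFree m 0) (cyclicRunFreeCount≡L n m (s≤s z≤n)))) ⟩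
      sumWords m (λ w → boolToℕ (not (cyclicRunFree 0 w))) + sumWords m (λ w → boolToℕ (cyclicRunFree 0 w))
    ≡⟨ sumWords-distrib-+ m (boolToℕ ∘ not ∘ cyclicRunFree 0) (boolToℕ ∘ cyclicRunFree 0) ⟨
      sumWords m (λ w → boolToℕ (not (cyclicRunFree 0 w)) + boolToℕ (cyclicRunFree 0 w))
    ≡⟨ sumWords-cong m (boolToℕ-not ∘ cyclicRunFree 0) ⟩
      sumWords m (λ _ → 1)
    ≡⟨ sumWords-one m ⟩
      2 ^ m
    ∎
    where
      open RunFree (suc n)
      hasZRun≡not : ∀ w → does (hasZRun? l (suc n) (periodicWord w)) ≡ not (cyclicRunFree 0 w)
      hasZRun≡not w = does-⇔-≡false (⇔-sym cyclic ⇔-∘ HasZRun⇔HasRun (suc n) w) (hasZRun? l (suc n) (periodicWord w))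
        where
          cyclic = PeriodicRuns.cyclicRunFree⇔HasRun (suc n) z<s m (w !_) 0 w refl (λ _ ()) (λ _ j<m → cycle-< w j<m)

lemma5p13 : (l : ℕ) .{{_ : NonZero l}} → (n : ℕ) → n ≤ l → (m : ℕ) → 1 ≤ m → m ∣ l →
    countFixed l n m + L n m ≡ 2 ^ m
lemma5p13 l n _ (suc m′) _ m∣l with l ∸ suc m′ | m+[n∸m]≡n (∣⇒≤ m∣l)
... | r | refl = FixedWords.countFixed+L m′ r m∣l n
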